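{- Let $v_0(m)$ be the number of permutations of $[m]$ with no occurrence of the pattern $23\text{ - }1$, and $v_0(n;i)$ the number of such permutations $a_1\cdots a_n$ of $[n]$ with $a_1=i$. If $2\le i\le n-1$, then $$v_0(n;i)=\sum_{j=0}^{i-2}\binom{i-2}{j}v_0(n-2-j).$$
   Context: An occurrence of the pattern $23\text{ - }1$ in a permutation $a_1a_2\cdots a_n$ is a pair of indices $(i,j)$ with $i+1<j\le n$ such that $a_j<a_i<a_{i+1}$. The empty permutation avoids the pattern, so $v_0(0)=1$. -}

module Defs where

open import Data.Nat using (ℕ; zero; suc; _+_; _∸_; _<_; _<?_; _≟_)
open import Data.List using (List; []; _∷_; map; concatMap; filter; length; applyUpTo; upTo)
open import Data.Nat.ListAction using (sum)
open import Data.List.Relation.Unary.Any using (Any; any?)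
import Data.List.Relation.Unary.Unique.DecPropositional as UDec
open import Data.Sum using (_⊎_; inj₁; inj₂)
open import Data.Product using (_×_; _,_)
open import Relation.Nullary using (Dec; ¬_; yes; no)
open import Relation.Nullary.Decidable using (¬?; _×-dec_; _⊎-dec_)

range : ℕ → List ℕ
range n = applyUpTo suc n

words : ℕ → ℕ → List (List ℕ)
words n zero    = [] ∷ []
words n (suc k) = concatMap (λ a → map (a ∷_) (words n k)) (range n)

perms : ℕ → List (List ℕ)
perms n = filter (UDec.unique? _≟_) (words n n)

-- Has23-1 w : w = a₁⋯a_m has an occurrence of 23-1, i.e. indices i+1<j
-- with a_j < a_i < a_{i+1}.
Has23-1 : List ℕ → Set
Has23-1 []             = Data.Empty.⊥
  where import Data.Empty
Has23-1 (x ∷ [])       = Data.Empty.⊥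
  where import Data.Empty
Has23-1 (x ∷ y ∷ rest) = (x < y × Any (λ z → z < x) rest) ⊎ Has23-1 (y ∷ rest)

has23-1? : (w : List ℕ) → Dec (Has23-1 w)
has23-1? []             = no (λ ())
has23-1? (x ∷ [])       = no (λ ())
has23-1? (x ∷ y ∷ rest) =
  ((x <? y) ×-dec any? (λ z → z <? x) rest) ⊎-dec has23-1? (y ∷ rest)

avoiders : ℕ → List (List ℕ)
avoiders m = filter (λ w → ¬? (has23-1? w)) (perms m)

v0 : ℕ → ℕ
v0 m = length (avoiders m)

FirstIs : ℕ → List ℕ → Set
FirstIs i []      = Data.Empty.⊥
  where import Data.Empty
FirstIs i (a ∷ _) = a Relation.Binary.PropositionalEquality.≡ i
  where import Relation.Binary.PropositionalEquality

firstIs? : (i : ℕ) → (w : List ℕ) → Dec (FirstIs i w)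
firstIs? i []      = no (λ ())
firstIs? i (a ∷ _) = a ≟ i

v0at : ℕ → ℕ → ℕ
v0at n i = length (filter (firstIs? i) (avoiders n))

sumTo : ℕ → (ℕ → ℕ) → ℕ
sumTo k f = sum (map f (upTo (suc k)))

-- Whether a word contains 23-1 depends only on the relative order of its
-- entries, so we count the 23-1-avoiding arrangements of an arbitrary finite
-- set S of positive numbers.  If the first entry x is the minimum of S, it can
-- start no occurrence, and deleting it leaves an arbitrary avoider of S ∖ x.
-- Otherwise some smaller s ∈ S comes later, so the second entry y must be
-- below x (else x y s is an occurrence); again x starts no occurrence, and
-- deleting it leaves an avoider of S ∖ x starting with y, whose rank in S ∖ x
-- is its rank in S.  Hence the counts depend only on |S| and the rank of the
-- first entry, through a recurrence which Pascal's rule unfolds into the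
-- binomial sum.

module Submission where

open import Defs
open import Data.Nat using (ℕ; _≤_; _∸_; _+_; _*_)
open import Data.Nat.Combinatorics using (_C_)
open import Relation.Binary.PropositionalEquality using (_≡_)

open import Data.Nat using (zero; suc; _<_; _≟_; _≤ᵇ_; z≤n; s≤s)
open import Algebra.Properties.CommutativeSemigroup using (interchange)
open import Data.Bool using (Bool; true; false; T; if_then_else_)
open import Data.Bool.Properties using (T-≡; if-float)
open import Data.Empty using (⊥-elim)
open import Data.List using (List; []; _∷_; _++_; map; concatMap; filter; length; applyUpTo)
open import Data.List.Properties
  using (filter-++; length-++; filter-≐; filter-accept; filter-reject; filter-none)
open import Data.List.Membership.Propositional using (_∈_)
open import Data.List.Membership.DecPropositional _≟_ using (_∈?_)
open import Data.List.Relation.Unary.All as All using (All; []; _∷_)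
open import Data.List.Relation.Unary.All.Properties
  using (All¬⇒¬Any; ¬Any⇒All¬; map⁺; concat⁺; applyUpTo⁺₁)
open import Data.List.Relation.Unary.AllPairs using ([]; _∷_)
open import Data.List.Relation.Unary.Any as Any using (here; there)
open import Data.List.Relation.Unary.Any.Properties using (¬Any[])
open import Data.List.Relation.Unary.Unique.Propositional using (Unique)
open import Data.List.Relation.Unary.Unique.DecPropositional _≟_ using (unique?)
open import Data.Nat.Combinatorics using (nCk+nC[k+1]≡[n+1]C[k+1]; k>n⇒nCk≡0)
open import Data.Nat.ListAction using (sum)
open import Data.Nat.Properties
open import Data.Product using (_×_; _,_; proj₁; proj₂; ∃-syntax)
open import Data.Sum using (inj₁; inj₂)
open import Data.Unit using (tt)
open import Function using (_∘_; id; Equivalence)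
open import Relation.Nullary using (¬_; yes; no)
open import Relation.Nullary.Decidable using (_×-dec_; ¬?; T?)
open import Relation.Unary using (Decidable; _≐_)
open import Relation.Binary.PropositionalEquality
  using (_≢_; refl; sym; trans; cong; cong₂; subst; module ≡-Reasoning)
open ≡-Reasoning

sumBelow : ℕ → (ℕ → ℕ) → ℕ
sumBelow zero    f = 0
sumBelow (suc b) f = sumBelow b f + f b

sumBelow-cong : ∀ b {f g : ℕ → ℕ} → (∀ {y} → y < b → f y ≡ g y) →
                sumBelow b f ≡ sumBelow b g
sumBelow-cong zero    eq = refl
sumBelow-cong (suc b) eq = cong₂ _+_ (sumBelow-cong b (eq ∘ m<n⇒m<1+n)) (eq (n<1+n b))

sumBelow-zero : ∀ b {f : ℕ → ℕ} → (∀ {y} → y < b → f y ≡ 0) → sumBelow b f ≡ 0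
sumBelow-zero zero    eq = refl
sumBelow-zero (suc b) eq = cong₂ _+_ (sumBelow-zero b (eq ∘ m<n⇒m<1+n)) (eq (n<1+n b))

sumBelow-+ : ∀ b (f g : ℕ → ℕ) →
             sumBelow b (λ y → f y + g y) ≡ sumBelow b f + sumBelow b g
sumBelow-+ zero    f g = refl
sumBelow-+ (suc b) f g =
  trans (cong (_+ (f b + g b)) (sumBelow-+ b f g))
        (interchange +-commutativeSemigroup (sumBelow b f) (sumBelow b g) (f b) (g b))

sumBelow-suc : ∀ b (f : ℕ → ℕ) → sumBelow (suc b) f ≡ f 0 + sumBelow b (f ∘ suc)
sumBelow-suc zero    f = +-comm 0 (f 0)
sumBelow-suc (suc b) f =
  trans (cong (_+ f (suc b)) (sumBelow-suc b f)) (+-assoc (f 0) _ _)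

sumBelow-truncate : ∀ {x} b {f : ℕ → ℕ} → x ≤ b → (∀ {y} → x ≤ y → f y ≡ 0) →
                    sumBelow b f ≡ sumBelow x f
sumBelow-truncate b x≤b eq with m≤n⇒m<n∨m≡n x≤b
... | inj₂ refl = refl
sumBelow-truncate (suc b) x≤b eq | inj₁ x<1+b =
  trans (cong₂ _+_ (sumBelow-truncate b (≤-pred x<1+b) eq) (eq (≤-pred x<1+b)))
        (+-identityʳ _)

sumBelow-single : ∀ {i} b {f : ℕ → ℕ} → i < b → (∀ {y} → y ≢ i → f y ≡ 0) →
                  sumBelow b f ≡ f i
sumBelow-single {i} b {f} i<b eq = begin
  sumBelow b f         ≡⟨ sumBelow-truncate b i<b (eq ∘ >⇒≢) ⟩
  sumBelow i f + f i   ≡⟨ cong (_+ f i) (sumBelow-zero i (eq ∘ <⇒≢)) ⟩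
  f i                  ∎

sum-map-applyUpTo : ∀ (F f : ℕ → ℕ) m → sum (map F (applyUpTo f m)) ≡ sumBelow m (F ∘ f)
sum-map-applyUpTo F f zero    = refl
sum-map-applyUpTo F f (suc m) =
  trans (cong (F (f 0) +_) (sum-map-applyUpTo F (f ∘ suc) m)) (sym (sumBelow-suc m (F ∘ f)))

sumTo≡sumBelow : ∀ r f → sumTo r f ≡ sumBelow (suc r) f
sumTo≡sumBelow r f = sum-map-applyUpTo f id (suc r)

sum-map-range : ∀ (F : ℕ → ℕ) n → F 0 ≡ 0 → sum (map F (range n)) ≡ sumBelow (suc n) F
sum-map-range F n F0≡0 = begin
  sum (map F (range n))       ≡⟨ sum-map-applyUpTo F suc n ⟩
  sumBelow n (F ∘ suc)        ≡⟨ cong (_+ sumBelow n (F ∘ suc)) (sym F0≡0) ⟩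
  F 0 + sumBelow n (F ∘ suc)  ≡⟨ sym (sumBelow-suc n F) ⟩
  sumBelow (suc n) F          ∎

pascal-sum : ∀ r (a : ℕ → ℕ) →
  sumBelow (suc r) (λ j → (r C j) * a j) + sumBelow (suc r) (λ j → (r C j) * a (suc j))
  ≡ sumBelow (suc (suc r)) (λ j → (suc r C j) * a j)
pascal-sum r a = begin
  sumBelow (suc r) A + sumBelow (suc r) B
    ≡⟨ cong (_+ sumBelow (suc r) B) (sumBelow-suc r A) ⟩
  A 0 + sumBelow r (A ∘ suc) + sumBelow (suc r) B
    ≡⟨ cong (λ t → A 0 + t + sumBelow (suc r) B) (sym lastTerm-vanishes) ⟩
  A 0 + sumBelow (suc r) (A ∘ suc) + sumBelow (suc r) B
    ≡⟨ +-assoc (A 0) _ _ ⟩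
  A 0 + (sumBelow (suc r) (A ∘ suc) + sumBelow (suc r) B)
    ≡⟨ cong (A 0 +_) (sym (sumBelow-+ (suc r) (A ∘ suc) B)) ⟩
  A 0 + sumBelow (suc r) (λ j → A (suc j) + B j)
    ≡⟨ cong (A 0 +_) (sumBelow-cong (suc r) (λ {j} _ → pascal j)) ⟩
  A 0 + sumBelow (suc r) (λ j → (suc r C suc j) * a (suc j))
    ≡⟨ sym (sumBelow-suc (suc r) _) ⟩
  sumBelow (suc (suc r)) (λ j → (suc r C j) * a j) ∎
  where
  A B : ℕ → ℕ
  A j = (r C j) * a j
  B j = (r C j) * a (suc j)

  lastTerm-vanishes : sumBelow (suc r) (A ∘ suc) ≡ sumBelow r (A ∘ suc)
  lastTerm-vanishes =
    trans (cong (λ c → sumBelow r (A ∘ suc) + c * a (suc r)) (k>n⇒nCk≡0 (n<1+n r)))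
          (+-identityʳ _)

  pascal : ∀ j → A (suc j) + B j ≡ (suc r C suc j) * a (suc j)
  pascal j = begin
    (r C suc j) * a (suc j) + (r C j) * a (suc j)
      ≡⟨ *-distribʳ-+ (a (suc j)) (r C suc j) (r C j) ⟨
    ((r C suc j) + (r C j)) * a (suc j)
      ≡⟨ cong (_* a (suc j)) (+-comm (r C suc j) (r C j)) ⟩
    ((r C j) + (r C suc j)) * a (suc j)
      ≡⟨ cong (_* a (suc j)) (nCk+nC[k+1]≡[n+1]C[k+1] r j) ⟩
    (suc r C suc j) * a (suc j) ∎

-- avoidTotal k counts the 23-1 avoiders among the arrangements of a k-element
-- set, avoidByFirstRank k r those whose first entry has exactly r smaller
-- elements in the set.
mutual
  avoidTotal : ℕ → ℕ
  avoidTotal zero    = 1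
  avoidTotal (suc k) = sumBelow (suc k) (avoidByFirstRank (suc k))

  avoidByFirstRank : ℕ → ℕ → ℕ
  avoidByFirstRank zero    r       = 0
  avoidByFirstRank (suc k) zero    = avoidTotal k
  avoidByFirstRank (suc k) (suc r) = sumBelow (suc r) (avoidByFirstRank k)

avoidByFirstRank-binomial : ∀ {r k} → r ≤ k →
  avoidByFirstRank (2 + k) (suc r) ≡ sumBelow (suc r) (λ j → (r C j) * avoidTotal (k ∸ j))
avoidByFirstRank-binomial {zero}  {k}     _         = cong (0 +_) (sym (*-identityˡ (avoidTotal k)))
avoidByFirstRank-binomial {suc r} {suc k} (s≤s r≤k) =
  trans (cong₂ _+_ (avoidByFirstRank-binomial (m≤n⇒m≤1+n r≤k)) (avoidByFirstRank-binomial r≤k))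
        (pascal-sum r (λ j → avoidTotal (suc k ∸ j)))

count : {A : Set} {P : A → Set} → Decidable P → List A → ℕ
count P? xs = length (filter P? xs)

module _ {A : Set} {P : A → Set} (P? : Decidable P) where

  count-none : (∀ x → ¬ P x) → ∀ xs → count P? xs ≡ 0
  count-none ¬P xs = cong length (filter-none P? (All.universal ¬P xs))

  count-none-on : ∀ {R : A → Set} {xs} → All R xs → (∀ {x} → R x → ¬ P x) → count P? xs ≡ 0
  count-none-on rs ¬P = cong length (filter-none P? (All.map ¬P rs))

  count-++ : ∀ xs ys → count P? (xs ++ ys) ≡ count P? xs + count P? ys
  count-++ xs ys = trans (cong length (filter-++ P? xs ys)) (length-++ (filter P? xs))

  count-map : ∀ {B : Set} (f : B → A) xs → count P? (map f xs) ≡ count (P? ∘ f) xs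
  count-map f []       = refl
  count-map f (x ∷ xs) with P? (f x)
  ... | yes _ = cong suc (count-map f xs)
  ... | no  _ = count-map f xs

module _ {A : Set} {P Q : A → Set} (P? : Decidable P) (Q? : Decidable Q) where

  count-≐ : P ≐ Q → ∀ xs → count P? xs ≡ count Q? xs
  count-≐ P≐Q xs = cong length (filter-≐ P? Q? P≐Q xs)

  count-cong-on : ∀ {R : A → Set} {xs} → All R xs →
                  (∀ {x} → R x → P x → Q x) → (∀ {x} → R x → Q x → P x) →
                  count P? xs ≡ count Q? xs
  count-cong-on {xs = []}     []       to from = refl
  count-cong-on {xs = x ∷ xs} (r ∷ rs) to from with P? x | Q? x
  ... | yes _  | yes _  = cong suc (count-cong-on rs to from)
  ... | no  _  | no  _  = count-cong-on rs to from
  ... | yes p  | no ¬q  = ⊥-elim (¬q (to r p))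
  ... | no ¬p  | yes q  = ⊥-elim (¬p (from r q))

  count-filter : ∀ xs → count P? (filter Q? xs) ≡ count (λ x → Q? x ×-dec P? x) xs
  count-filter []       = refl
  count-filter (x ∷ xs) with Q? x
  ... | no  _ = count-filter xs
  ... | yes _ with P? x
  ...   | yes _ = cong suc (count-filter xs)
  ...   | no  _ = count-filter xs

count-words : ∀ {P : List ℕ → Set} (P? : Decidable P) n k →
  count P? (words n (suc k)) ≡ sum (map (λ a → count (λ w → P? (a ∷ w)) (words n k)) (range n))
count-words P? n k = count-concat (range n)
  where
  count-concat : ∀ as → count P? (concatMap (λ a → map (a ∷_) (words n k)) as)
                 ≡ sum (map (λ a → count (λ w → P? (a ∷ w)) (words n k)) as)
  count-concat []       = refl
  count-concat (a ∷ as) =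
    trans (count-++ P? (map (a ∷_) (words n k)) _)
          (cong₂ _+_ (count-map P? (a ∷_) (words n k)) (count-concat as))

-- Opaque, so that implicit arguments of lemmas about S ∖ x are inferred from
-- that shape rather than from its unfolding.
opaque
  _∖_ : (ℕ → Bool) → ℕ → ℕ → Bool
  (S ∖ x) s with s ≟ x
  ... | yes _ = false
  ... | no  _ = S s

  ∖-≢-apply : ∀ {S x s} → s ≢ x → (S ∖ x) s ≡ S s
  ∖-≢-apply {x = x} {s} s≢x with s ≟ x
  ... | yes s≡x = ⊥-elim (s≢x s≡x)
  ... | no  _   = refl

  ∖-self : ∀ {S x} → (S ∖ x) x ≡ false
  ∖-self {x = x} with x ≟ x
  ... | yes _   = refl
  ... | no  x≢x = ⊥-elim (x≢x refl)

∖-intro : ∀ {S x s} → s ≢ x → T (S s) → T ((S ∖ x) s)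
∖-intro s≢x = subst T (sym (∖-≢-apply s≢x))

∖-≢ : ∀ {S x s} → T ((S ∖ x) s) → s ≢ x
∖-≢ {S} {x} p refl = subst T (∖-self {S}) p

∖-⊆ : ∀ {S x s} → T ((S ∖ x) s) → T (S s)
∖-⊆ {x = x} {s} p with s ≟ x
... | yes s≡x = ⊥-elim (∖-≢ p s≡x)
... | no  s≢x = subst T (∖-≢-apply s≢x) p

rank : (ℕ → Bool) → ℕ → ℕ
rank S zero    = 0
rank S (suc b) = if S b then suc (rank S b) else rank S b

rank-∖-below : ∀ {S x} b → b ≤ x → rank (S ∖ x) b ≡ rank S b
rank-∖-below zero    _ = refl
rank-∖-below {S} {x} (suc b) b<x with b ≟ x
... | yes b≡x = ⊥-elim (<-irrefl b≡x b<x)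
... | no  b≢x = cong₂ (λ c t → if c then suc t else t) (∖-≢-apply b≢x) (rank-∖-below b (<⇒≤ b<x))

rank-∖ : ∀ {S x b} → T (S x) → x < b → rank S b ≡ suc (rank (S ∖ x) b)
rank-∖ {S} {x} {suc b} Sx x<1+b with m≤n⇒m<n∨m≡n (≤-pred x<1+b)
... | inj₂ refl = begin
  (if S x then suc (rank S x) else rank S x)
    ≡⟨ cong (λ c → if c then suc (rank S x) else rank S x) (Equivalence.to T-≡ Sx) ⟩
  suc (rank S x)
    ≡⟨ cong suc (rank-∖-below x ≤-refl) ⟨
  suc (rank (S ∖ x) x)
    ≡⟨ cong (λ c → suc (if c then suc (rank (S ∖ x) x) else rank (S ∖ x) x)) ∖-self ⟨
  suc (rank (S ∖ x) (suc x)) ∎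
... | inj₁ x<b = begin
  (if S b then suc (rank S b) else rank S b)
    ≡⟨ cong (λ t → if S b then suc t else t) (rank-∖ Sx x<b) ⟩
  (if S b then suc (suc R) else suc R)
    ≡⟨ if-float suc (S b) ⟨
  suc (if S b then suc R else R)
    ≡⟨ cong (λ c → suc (if c then suc R else R)) (∖-≢-apply (>⇒≢ x<b)) ⟨
  suc (rank (S ∖ x) (suc b)) ∎
  where
  R = rank (S ∖ x) b

rank≡0⇒∉ : ∀ {S} b → rank S b ≡ 0 → ∀ {a} → a < b → ¬ T (S a)
rank≡0⇒∉ {S} (suc b) r≡0 a<1+b Sa with S b in Sb | m≤n⇒m<n∨m≡n (≤-pred a<1+b)
... | false | inj₁ a<b  = rank≡0⇒∉ b r≡0 a<b Sa
... | false | inj₂ refl = subst T Sb Sa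

rank≡suc⇒∈ : ∀ {S} b {r} → rank S b ≡ suc r → ∃[ a ] a < b × T (S a)
rank≡suc⇒∈ {S} (suc b) r≡1+r with S b in Sb
... | true  = b , n<1+n b , subst T (sym Sb) tt
... | false with rank≡suc⇒∈ b r≡1+r
...   | a , a<b , Sa = a , m<n⇒m<1+n a<b , Sa

if-then-0-intro : ∀ b {u v : ℕ} → (T b → u ≡ v) → (¬ T b → u ≡ 0) → u ≡ (if b then v else 0)
if-then-0-intro true  member _   = member tt
if-then-0-intro false _      ∉ = ∉ id

rank-sum : ∀ S (f : ℕ → ℕ) b →
           sumBelow b (λ y → if S y then f (rank S y) else 0) ≡ sumBelow (rank S b) f
rank-sum S f zero    = refl
rank-sum S f (suc b) with S b
... | true  = cong (_+ f (rank S b)) (rank-sum S f b)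
... | false = trans (+-identityʳ _) (rank-sum S f b)

length≤rank : ∀ S {b} w → Unique w → All (λ a → a < b × T (S a)) w → length w ≤ rank S b
length≤rank S []      _           _               = z≤n
length≤rank S (a ∷ w) (a∉w ∷ u) ((a<b , Sa) ∷ ws) =
  subst (suc (length w) ≤_) (sym (rank-∖ Sa a<b))
        (s≤s (length≤rank (S ∖ a) w u
               (All.zipWith (λ (a≢c , c<b , Sc) → c<b , ∖-intro (a≢c ∘ sym) Sc) (a∉w , ws))))

Has23-1-∷ : ∀ x {w} → Has23-1 w → Has23-1 (x ∷ w)
Has23-1-∷ x {_ ∷ _} h = inj₂ h

Has23-1-∷⁻-min : ∀ {x w} → All (λ a → ¬ a < x) w → Has23-1 (x ∷ w) → Has23-1 w
Has23-1-∷⁻-min (_ ∷ notBelow) (inj₁ (_ , below)) = ⊥-elim (All¬⇒¬Any notBelow below)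
Has23-1-∷⁻-min (_ ∷ _)        (inj₂ h)            = h

Has23-1-∷⁻-descent : ∀ {x y w} → y < x → Has23-1 (x ∷ y ∷ w) → Has23-1 (y ∷ w)
Has23-1-∷⁻-descent y<x (inj₁ (x<y , _)) = ⊥-elim (<-asym x<y y<x)
Has23-1-∷⁻-descent y<x (inj₂ h)         = h

DistinctIn : (ℕ → Bool) → List ℕ → Set
DistinctIn S w = Unique w × All (T ∘ S) w

distinctIn-∷⁻ : ∀ {S x w} → DistinctIn S (x ∷ w) → T (S x) × DistinctIn (S ∖ x) w
distinctIn-∷⁻ (x∉w ∷ u , Sx ∷ Sw) =
  Sx , u , All.zipWith (λ (x≢a , Sa) → ∖-intro (x≢a ∘ sym) Sa) (x∉w , Sw)

distinctIn-∷⁺ : ∀ {S x w} → T (S x) → DistinctIn (S ∖ x) w → DistinctIn S (x ∷ w)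
distinctIn-∷⁺ Sx (u , Dw) = All.map (λ Da → ∖-≢ Da ∘ sym) Dw ∷ u , Sx ∷ All.map ∖-⊆ Dw

Avoider : (ℕ → Bool) → List ℕ → Set
Avoider S w = DistinctIn S w × ¬ Has23-1 w

avoider? : ∀ S → Decidable (Avoider S)
avoider? S w = (unique? w ×-dec All.all? (T? ∘ S) w) ×-dec ¬? (has23-1? w)

-- Finite sets are Boolean predicates on ℕ; n bounds the alphabet of the
-- counted words.
module Ambient (n : ℕ) where

  Supported : (ℕ → Bool) → Set
  Supported S = ∀ {s} → T (S s) → 1 ≤ s × s ≤ n

  ∣_∣ : (ℕ → Bool) → ℕ
  ∣ S ∣ = rank S (suc n)

  ∣∖∣ : ∀ {S x k} → Supported S → T (S x) → ∣ S ∣ ≡ suc k → ∣ S ∖ x ∣ ≡ k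
  ∣∖∣ supp Sx size = suc-injective (trans (sym (rank-∖ Sx (s≤s (proj₂ (supp Sx))))) size)

  covers : ∀ {S w s} → Supported S → DistinctIn S w → length w ≡ ∣ S ∣ → T (S s) → s ∈ w
  covers {S} {w} {s} supp (u , Sw) len Ss with s ∈? w
  ... | yes s∈w = s∈w
  ... | no  s∉w = ⊥-elim (1+n≰n (subst (_≤ rank (S ∖ s) (suc n)) w-too-long w-short))
    where
    w-too-long : length w ≡ suc (rank (S ∖ s) (suc n))
    w-too-long = trans len (rank-∖ Ss (s≤s (proj₂ (supp Ss))))

    w-short : length w ≤ rank (S ∖ s) (suc n)
    w-short = length≤rank (S ∖ s) w u
      (All.zipWith (λ (s≢a , Sa) → s≤s (proj₂ (supp Sa)) , ∖-intro (s≢a ∘ sym) Sa)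
                   (¬Any⇒All¬ w s∉w , Sw))

  smaller-in-tail : ∀ {S x w s} → Supported S → DistinctIn S (x ∷ w) → length (x ∷ w) ≡ ∣ S ∣ →
                    s < x → T (S s) → s ∈ w
  smaller-in-tail supp d len s<x Ss with covers supp d len Ss
  ... | here s≡x  = ⊥-elim (<⇒≢ s<x s≡x)
  ... | there s∈w = s∈w

  words-length : ∀ k → All (λ w → length w ≡ k) (words n k)
  words-length zero    = refl ∷ []
  words-length (suc k) =
    concat⁺ (map⁺ (All.universal (λ _ → map⁺ (All.map (cong suc) (words-length k))) (range n)))

  -- The words of length k are counted; when k = ∣ S ∣, covers shows that the
  -- distinct ones over S are exactly the arrangements of S.
  #Avoiders : (ℕ → Bool) → ℕ → ℕ
  #Avoiders S k = count (avoider? S) (words n k)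

  #AvoidersFrom : (ℕ → Bool) → ℕ → ℕ → ℕ
  #AvoidersFrom S k x = count (λ w → avoider? S (x ∷ w)) (words n k)

  #AvoidersFrom₂ : (ℕ → Bool) → ℕ → ℕ → ℕ → ℕ
  #AvoidersFrom₂ S k x y = count (λ w → avoider? S (x ∷ y ∷ w)) (words n k)

  #AvoidersFrom-∉ : ∀ {S k x} → ¬ T (S x) → #AvoidersFrom S k x ≡ 0
  #AvoidersFrom-∉ {S} {k} {x} ¬Sx =
    count-none (λ w → avoider? S (x ∷ w)) (λ _ ((_ , Sxw) , _) → ¬Sx (All.head Sxw)) (words n k)

  #Avoiders-suc : ∀ {S k} → Supported S → #Avoiders S (suc k) ≡ sumBelow (suc n) (#AvoidersFrom S k)
  #Avoiders-suc {S} {k} supp =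
    trans (count-words (avoider? S) n k)
          (sum-map-range _ n (#AvoidersFrom-∉ {S} {k} (n≮0 ∘ proj₁ ∘ supp)))

  #AvoidersFrom-min : ∀ {S k x} → T (S x) → (∀ {a} → a < x → ¬ T (S a)) →
                      #AvoidersFrom S k x ≡ #Avoiders (S ∖ x) k
  #AvoidersFrom-min {S} {k} {x} Sx minimal = count-≐ _ _ (to , from) (words n k)
    where
    to : ∀ {w} → Avoider S (x ∷ w) → Avoider (S ∖ x) w
    to (d , ¬h) = proj₂ (distinctIn-∷⁻ d) , ¬h ∘ Has23-1-∷ x

    from : ∀ {w} → Avoider (S ∖ x) w → Avoider S (x ∷ w)
    from (d@(_ , Sw) , ¬h) =
      distinctIn-∷⁺ Sx d , ¬h ∘ Has23-1-∷⁻-min (All.map (λ Sa a<x → minimal a<x (∖-⊆ Sa)) Sw)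

  #AvoidersFrom₂-descent : ∀ {S k x y} → T (S x) → y < x →
                           #AvoidersFrom₂ S k x y ≡ #AvoidersFrom (S ∖ x) k y
  #AvoidersFrom₂-descent {S} {k} {x} Sx y<x = count-≐ _ _ (to , from) (words n k)
    where
    to : ∀ {w} → Avoider S (x ∷ _ ∷ w) → Avoider (S ∖ x) (_ ∷ w)
    to (d , ¬h) = proj₂ (distinctIn-∷⁻ d) , ¬h ∘ Has23-1-∷ x

    from : ∀ {w} → Avoider (S ∖ x) (_ ∷ w) → Avoider S (x ∷ _ ∷ w)
    from (d , ¬h) = distinctIn-∷⁺ Sx d , ¬h ∘ Has23-1-∷⁻-descent y<x

  #AvoidersFrom₂-ascent : ∀ {S k x y s} → Supported S → ∣ S ∣ ≡ 2 + k → T (S s) → s < x → x ≤ y →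
                          #AvoidersFrom₂ S k x y ≡ 0
  #AvoidersFrom₂-ascent {S} {k} {x} {y} {s} supp size Ss s<x x≤y =
    count-none-on _ (words-length k) blocked
    where
    blocked : ∀ {w} → length w ≡ k → ¬ Avoider S (x ∷ y ∷ w)
    blocked len (d@(x∉yw ∷ _ , _) , ¬h)
      with smaller-in-tail supp d (trans (cong (2 +_) len) (sym size)) s<x Ss
    ... | here s≡y  = <-irrefl s≡y (<-≤-trans s<x x≤y)
    ... | there s∈w =
      ¬h (inj₁ (≤∧≢⇒< x≤y (All.head x∉yw) , Any.map (λ s≡a → subst (_< x) s≡a s<x) s∈w))

  #AvoidersFrom-singleton : ∀ {S x s} → Supported S → ∣ S ∣ ≡ 1 → T (S s) → s < x →
                            #AvoidersFrom S 0 x ≡ 0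
  #AvoidersFrom-singleton {S} {x} supp size Ss s<x =
    cong length (filter-reject (λ w → avoider? S (x ∷ w))
                               (λ (d , _) → ¬Any[] (smaller-in-tail supp d (sym size) s<x Ss)))

  #AvoidersFrom-nonmin : ∀ {S k x s} → Supported S → ∣ S ∣ ≡ 2 + k → T (S x) → T (S s) → s < x →
                         #AvoidersFrom S (suc k) x ≡ sumBelow x (#AvoidersFrom (S ∖ x) k)
  #AvoidersFrom-nonmin {S} {k} {x} supp size Sx Ss s<x = begin
    #AvoidersFrom S (suc k) x
      ≡⟨ count-words _ n k ⟩
    sum (map (#AvoidersFrom₂ S k x) (range n))
      ≡⟨ sum-map-range _ n starts-with-0 ⟩
    sumBelow (suc n) (#AvoidersFrom₂ S k x)
      ≡⟨ sumBelow-truncate (suc n) (m≤n⇒m≤1+n (proj₂ (supp Sx)))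
                           (#AvoidersFrom₂-ascent {S} {k} supp size Ss s<x) ⟩
    sumBelow x (#AvoidersFrom₂ S k x)
      ≡⟨ sumBelow-cong x (#AvoidersFrom₂-descent {S} {k} Sx) ⟩
    sumBelow x (#AvoidersFrom (S ∖ x) k) ∎
    where
    starts-with-0 : #AvoidersFrom₂ S k x 0 ≡ 0
    starts-with-0 = trans (#AvoidersFrom₂-descent {S} {k} Sx (≤-<-trans z≤n s<x))
                          (#AvoidersFrom-∉ {S ∖ x} {k} (n≮0 ∘ proj₁ ∘ supp ∘ ∖-⊆))

  mutual
    #Avoiders-size : ∀ {S} k → Supported S → ∣ S ∣ ≡ k → #Avoiders S k ≡ avoidTotal k
    #Avoiders-size {S} zero    supp size =
      cong length (filter-accept (avoider? S) {xs = []} (([] , []) , λ ()))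
    #Avoiders-size {S} (suc k) supp size = begin
      #Avoiders S (suc k)
        ≡⟨ #Avoiders-suc {S} {k} supp ⟩
      sumBelow (suc n) (#AvoidersFrom S k)
        ≡⟨ sumBelow-cong (suc n) (λ {y} _ → #AvoidersFrom-size-if k supp size y) ⟩
      sumBelow (suc n) (λ y → if S y then avoidByFirstRank (suc k) (rank S y) else 0)
        ≡⟨ rank-sum S _ (suc n) ⟩
      sumBelow ∣ S ∣ (avoidByFirstRank (suc k))
        ≡⟨ cong (λ m → sumBelow m _) size ⟩
      avoidTotal (suc k) ∎

    #AvoidersFrom-size-if : ∀ {S} k → Supported S → ∣ S ∣ ≡ suc k → ∀ y →
      #AvoidersFrom S k y ≡ (if S y then avoidByFirstRank (suc k) (rank S y) else 0)
    #AvoidersFrom-size-if {S} k supp size y =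
      if-then-0-intro (S y) (#AvoidersFrom-size k supp size) (#AvoidersFrom-∉ {S} {k})

    #AvoidersFrom-size : ∀ {S x} k → Supported S → ∣ S ∣ ≡ suc k → T (S x) →
                         #AvoidersFrom S k x ≡ avoidByFirstRank (suc k) (rank S x)
    #AvoidersFrom-size {S} {x} k supp size Sx with rank S x in rk
    ... | zero  = trans (#AvoidersFrom-min {k = k} Sx (rank≡0⇒∉ x rk))
                        (#Avoiders-size k (supp ∘ ∖-⊆) (∣∖∣ supp Sx size))
    ... | suc r with rank≡suc⇒∈ x rk
    ...   | s , s<x , Ss = #AvoidersFrom-size-nonmin k supp size Sx Ss s<x rk

    #AvoidersFrom-size-nonmin : ∀ {S x s r} k → Supported S → ∣ S ∣ ≡ suc k → T (S x) → T (S s) →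
      s < x → rank S x ≡ suc r → #AvoidersFrom S k x ≡ avoidByFirstRank (suc k) (suc r)
    #AvoidersFrom-size-nonmin {r = r} zero supp size Sx Ss s<x rk =
      trans (#AvoidersFrom-singleton supp size Ss s<x) (sym (sumBelow-zero (suc r) (λ _ → refl)))
    #AvoidersFrom-size-nonmin {S} {x} {r = r} (suc k) supp size Sx Ss s<x rk = begin
      #AvoidersFrom S (suc k) x
        ≡⟨ #AvoidersFrom-nonmin supp size Sx Ss s<x ⟩
      sumBelow x (#AvoidersFrom (S ∖ x) k)
        ≡⟨ sumBelow-cong x (λ {y} _ → #AvoidersFrom-size-if k (supp ∘ ∖-⊆) (∣∖∣ supp Sx size) y) ⟩
      sumBelow x (λ y → if (S ∖ x) y then avoidByFirstRank (suc k) (rank (S ∖ x) y) else 0)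
        ≡⟨ rank-sum (S ∖ x) _ x ⟩
      sumBelow (rank (S ∖ x) x) (avoidByFirstRank (suc k))
        ≡⟨ cong (λ m → sumBelow m (avoidByFirstRank (suc k))) (trans (rank-∖-below x ≤-refl) rk) ⟩
      avoidByFirstRank (2 + k) (suc r) ∎

  full : ℕ → Bool
  full zero    = false
  full (suc s) = suc s ≤ᵇ n

  full-supported : Supported full
  full-supported {suc s} p = s≤s z≤n , ≤ᵇ⇒≤ (suc s) n p

  rank-full : ∀ {b} → b ≤ n → rank full (suc b) ≡ b
  rank-full {zero}  _   = refl
  rank-full {suc b} b<n with suc b ≤ᵇ n | ≤⇒≤ᵇ b<n
  ... | true | _ = cong suc (rank-full (<⇒≤ b<n))

  words-full : ∀ k → All (All (T ∘ full)) (words n k)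
  words-full zero    = [] ∷ []
  words-full (suc k) =
    concat⁺ (map⁺ (applyUpTo⁺₁ suc n (λ a<n → map⁺ (All.map (≤⇒≤ᵇ a<n ∷_) (words-full k)))))

v0≡avoidTotal : ∀ n → v0 n ≡ avoidTotal n
v0≡avoidTotal n = begin
  v0 n
    ≡⟨ count-filter _ _ (words n n) ⟩
  count (λ w → unique? w ×-dec ¬? (has23-1? w)) (words n n)
    ≡⟨ count-cong-on _ _ (words-full n) (λ Fw (u , ¬h) → (u , Fw) , ¬h)
                                        (λ _ ((u , _) , ¬h) → u , ¬h) ⟩
  #Avoiders full n
    ≡⟨ #Avoiders-size n full-supported (rank-full ≤-refl) ⟩
  avoidTotal n ∎
  where open Ambient n

v0at≡#AvoidersFrom : ∀ m {i} → i < suc m →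
  v0at (suc m) (suc i) ≡ Ambient.#AvoidersFrom (suc m) (Ambient.full (suc m)) m (suc i)
v0at≡#AvoidersFrom m {i} i<n = begin
  v0at (suc m) (suc i)
    ≡⟨ count-filter _ _ (filter unique? (words (suc m) (suc m))) ⟩
  count _ (filter unique? (words (suc m) (suc m)))
    ≡⟨ count-filter _ _ (words (suc m) (suc m)) ⟩
  count P? (words (suc m) (suc m))
    ≡⟨ count-words P? (suc m) m ⟩
  sum (map F (range (suc m)))
    ≡⟨ sum-map-applyUpTo F suc (suc m) ⟩
  sumBelow (suc m) (F ∘ suc)
    ≡⟨ sumBelow-single (suc m) i<n other-first-entry ⟩
  F (suc i)
    ≡⟨ count-cong-on _ _ (words-full m) (λ Fw (u , ¬h , _) → (u , ≤⇒≤ᵇ i<n ∷ Fw) , ¬h)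
                                        (λ _ ((u , _) , ¬h) → u , ¬h , refl) ⟩
  #AvoidersFrom full m (suc i) ∎
  where
  open Ambient (suc m)

  P? : Decidable (λ w → Unique w × ¬ Has23-1 w × FirstIs (suc i) w)
  P? w = unique? w ×-dec (¬? (has23-1? w) ×-dec firstIs? (suc i) w)

  F : ℕ → ℕ
  F a = count (λ w → P? (a ∷ w)) (words (suc m) m)

  other-first-entry : ∀ {a} → a ≢ i → F (suc a) ≡ 0
  other-first-entry {a} a≢i = count-none (λ w → P? (suc a ∷ w))
    (λ _ (_ , _ , first) → a≢i (suc-injective first)) (words (suc m) m)

lemma6 : (n i : ℕ) → 2 ≤ i → i ≤ n ∸ 1 →
         v0at n i ≡ sumTo (i ∸ 2) (λ j → ((i ∸ 2) C j) * v0 (n ∸ 2 ∸ j))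
lemma6 (suc (suc k)) (suc (suc r)) (s≤s (s≤s z≤n)) (s≤s r<k) = begin
  v0at (2 + k) (2 + r)
    ≡⟨ v0at≡#AvoidersFrom (suc k) (s≤s 1+r≤1+k) ⟩
  #AvoidersFrom full (suc k) (2 + r)
    ≡⟨ #AvoidersFrom-size (suc k) full-supported (rank-full ≤-refl) (≤⇒≤ᵇ (s≤s (s≤s 1+r≤1+k))) ⟩
  avoidByFirstRank (2 + k) (rank full (2 + r))
    ≡⟨ cong (avoidByFirstRank (2 + k)) (rank-full (m≤n⇒m≤1+n 1+r≤1+k)) ⟩
  avoidByFirstRank (2 + k) (1 + r)
    ≡⟨ avoidByFirstRank-binomial (<⇒≤ r<k) ⟩
  sumBelow (suc r) (λ j → (r C j) * avoidTotal (k ∸ j))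
    ≡⟨ sumBelow-cong (suc r) (λ {j} _ → cong ((r C j) *_) (v0≡avoidTotal (k ∸ j))) ⟨
  sumBelow (suc r) (λ j → (r C j) * v0 (k ∸ j))
    ≡⟨ sumTo≡sumBelow r _ ⟨
  sumTo r (λ j → (r C j) * v0 (k ∸ j)) ∎
  where
  open Ambient (2 + k)

  1+r≤1+k : 1 + r ≤ 1 + k
  1+r≤1+k = s≤s (<⇒≤ r<k)
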